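{- Let $r\ge 3$, let $T$ be a tree with $k$ edges and maximum degree $\Delta$, and let $\mathcal{H}$ be a hypergraph all of whose hyperedges have size between $2$ and $r$, containing no Berge copy of $T$. Then $\chi_s(\mathcal{H})\le k+(r-3)(k-1)+\Delta-1$.
   Context: A hypergraph contains a Berge copy of a graph $T$ if there are distinct hyperedges $f(e)$, $e\in E(T)$, and an injective map $\varphi:V(T)\to V(\mathcal{H})$ such that $\{\varphi(x),\varphi(y)\}\subseteq f(xy)$ for every edge $xy\in E(T)$. $\chi_s(\mathcal{H})$, the strong chromatic number, is the minimum number of colors in a vertex coloring such that every hyperedge is rainbow (all its vertices have distinct colors). -}

module Defs where

open import Data.Nat using (ℕ; zero; suc; _+_; _≤_)
open import Data.Fin using (Fin; zero; suc; inject₁; fromℕ)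
open import Data.Fin.Subset using (Subset; _∈_; ∣_∣)
open import Data.Product using (Σ; ∃; ∃-syntax; _×_; _,_; proj₁; proj₂)
open import Data.Sum using (_⊎_)
open import Relation.Binary.PropositionalEquality using (_≡_; _≢_)
open import Relation.Nullary using (¬_; Dec; yes; no)
open import Function.Definitions using (Injective)

-- Finite simple graphs given by an edge list.
-- Vertices are Fin t; edges are indexed by Fin k, each edge being an
-- ordered pair of endpoints (its orientation is irrelevant).

record Graph (t k : ℕ) : Set where
  field
    edge      : Fin k → Fin t × Fin t
    loopless  : ∀ e → proj₁ (edge e) ≢ proj₂ (edge e)
    simple    : ∀ e e' → proj₁ (edge e) ≡ proj₁ (edge e') → proj₂ (edge e) ≡ proj₂ (edge e') → e ≡ e'
    simple'   : ∀ e e' → proj₁ (edge e) ≡ proj₂ (edge e') → proj₂ (edge e) ≡ proj₁ (edge e') → e ≡ e'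
open Graph public

Adj : ∀ {t k} → Graph t k → Fin t → Fin t → Set
Adj G u v = ∃[ e ] ((edge G e ≡ (u , v)) ⊎ (edge G e ≡ (v , u)))

data Walk {t k} (G : Graph t k) : Fin t → Fin t → Set where
  here : ∀ {u} → Walk G u u
  step : ∀ {u w v} → Adj G u w → Walk G w v → Walk G u v

Connected : ∀ {t k} → Graph t k → Set
Connected G = ∀ u v → Walk G u v

-- a cycle of length j+3: distinct vertices c 0, …, c (j+2), consecutive
-- ones adjacent, and the last adjacent to the first
HasCycle : ∀ {t k} → Graph t k → Set
HasCycle {t} G = ∃[ j ] Σ (Fin (suc (suc (suc j))) → Fin t) λ c →
  Injective _≡_ _≡_ c
  × (∀ (i : Fin (suc (suc j))) → Adj G (c (inject₁ i)) (c (suc i)))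
  × Adj G (c (fromℕ (suc (suc j)))) (c zero)

IsTree : ∀ {t k} → Graph t k → Set
IsTree G = Connected G × ¬ HasCycle G

count : ∀ {k} {P : Fin k → Set} → (∀ e → Dec (P e)) → ℕ
count {zero}  d = 0
count {suc k} d with d zero
... | yes _ = suc (count (λ e → d (suc e)))
... | no  _ = count (λ e → d (suc e))

Incident : ∀ {t k} → Graph t k → Fin t → Fin k → Set
Incident G v e = (proj₁ (edge G e) ≡ v) ⊎ (proj₂ (edge G e) ≡ v)

degree : ∀ {t k} → Graph t k → Fin t → ℕ
degree G v = count (λ e → incident? e)
  where
  open import Data.Fin using (_≟_)
  open import Relation.Nullary.Decidable using (_⊎-dec_)
  incident? : ∀ e → Dec (Incident G v e)
  incident? e = (proj₁ (edge G e) ≟ v) ⊎-dec (proj₂ (edge G e) ≟ v)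

MaxDegree : ∀ {t k} → Graph t k → ℕ → Set
MaxDegree G Δ = (∀ v → degree G v ≤ Δ) × ∃[ v ] degree G v ≡ Δ

record Hypergraph (n m : ℕ) : Set where
  field
    hyperedge : Fin m → Subset n
    distinct  : Injective _≡_ _≡_ hyperedge
open Hypergraph public

HasBergeCopy : ∀ {n m t k} → Hypergraph n m → Graph t k → Set
HasBergeCopy {n} {m} {t} {k} H T =
  Σ (Fin t → Fin n) λ φ → Σ (Fin k → Fin m) λ f →
    Injective _≡_ _≡_ φ × Injective _≡_ _≡_ f
    × (∀ e → (φ (proj₁ (edge T e)) ∈ hyperedge H (f e))
           × (φ (proj₂ (edge T e)) ∈ hyperedge H (f e)))

IsStrongColouring : ∀ {n m} → Hypergraph n m → (c : ℕ) → (Fin n → Fin c) → Set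
IsStrongColouring H c col =
  ∀ i u v → u ∈ hyperedge H i → v ∈ hyperedge H i → col u ≡ col v → u ≡ v

-- χ_s(H) ≤ c  (χ_s is the least c admitting a strong colouring)
χs≤ : ∀ {n m} → Hypergraph n m → ℕ → Set
χs≤ {n} H c = Σ (Fin n → Fin c) (IsStrongColouring H c)

-- A strong colouring of H is exactly a proper colouring of its 2-shadow (u ~ v when u ≠ v lie
-- in a common hyperedge), so it suffices that the shadow is (D - 1)-degenerate, where
-- D = k + (r - 3)(k - 1) + Δ - 1. Otherwise some vertex set S has all shadow degrees inside S
-- at least D, and T embeds greedily into S as a Berge tree, one pendant edge xw at a time:
-- w needs a shadow neighbour u of φ(x) that is not yet an image, reached through a hyperedge
-- not yet used. At most k - 1 neighbours are images other than φ(x). A used hyperedge through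
-- φ(x) already contains the images of both ends of its edge, so it offers at most r - 3 other
-- neighbours, or r - 2 when its edge is incident to x, which happens for at most Δ - 1 used
-- edges. Altogether fewer than D neighbours are excluded.

module Submission where

open import Defs
open import Data.Bool using (if_then_else_)
open import Data.Fin using (Fin; zero; suc; _≟_; fromℕ<)
open import Data.Fin.Subset
  using (Subset; inside; outside; _∈_; _∉_; _⊆_; _⊂_; _⊃_; ∣_∣; _∪_; _∩_; _-_; ⁅_⁆; ⊤; ⋃; Nonempty)
  renaming (⊥ to ∅)
open import Data.Fin.Subset.Properties
open import Data.Fin.Subset.Induction using (⊂-wellFounded; ⊃-wellFounded)
open import Data.Fin.Properties using (any?; toℕ<n)
open import Data.List using (tabulate)
open import Data.Nat.ListAction using (sum)
open import Data.Nat using (ℕ; zero; suc; _+_; _*_; _∸_; _≤_; _<_; z≤n; s≤s; _<?_)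
open import Data.Nat.Properties hiding (_≟_)
open import Algebra.Properties.CommutativeSemigroup +-commutativeSemigroup using (interchange)
import Data.Product as Product
open import Data.Product using (_×_; _,_; proj₁; proj₂; ∃₂; ∃-syntax; Σ)
open import Data.Sum using (_⊎_; inj₁; inj₂; swap)
open import Data.Vec using (_∷_; []; here; there; lookup)
open import Data.Vec.Properties using ([]=⇒lookup)
open import Data.Vec.Functional using (updateAt)
open import Data.Vec.Functional.Properties using (updateAt-updates; updateAt-minimal)
open import Function using (_∘_; const; case_of_)
open import Induction.WellFounded using (Acc; acc)
open import Relation.Binary using (Decidable; Symmetric)
open import Relation.Binary.PropositionalEquality
open import Relation.Nullary using (¬_; Dec; yes; no; does; contradiction)
open import Relation.Nullary.Decidable using (_×-dec_; _⊎-dec_; ¬?; decidable-stable)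
import Relation.Unary as Unary

private
  variable
    k n n₁ n₂ : ℕ

select : {P : Fin n → Set} → Unary.Decidable P → Subset n
select {zero}  P? = []
select {suc n} P? = does (P? zero) ∷ select (P? ∘ suc)

∈-select⁺ : {P : Fin n → Set} (P? : Unary.Decidable P) {x : Fin n} → P x → x ∈ select P?
∈-select⁺ P? {zero} px with P? zero
... | yes _  = here
... | no ¬px = contradiction px ¬px
∈-select⁺ P? {suc x} px = there (∈-select⁺ (P? ∘ suc) px)

∈-select⁻ : {P : Fin n → Set} (P? : Unary.Decidable P) {x : Fin n} → x ∈ select P? → P x
∈-select⁻ P? {zero} x∈ with P? zero | x∈
... | yes px | _ = px
∈-select⁻ P? {suc x} (there x∈) = ∈-select⁻ (P? ∘ suc) x∈

count≡∣select∣ : {P : Fin n → Set} (P? : Unary.Decidable P) → count P? ≡ ∣ select P? ∣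
count≡∣select∣ {zero}  P? = refl
count≡∣select∣ {suc n} P? with P? zero
... | yes _ = cong suc (count≡∣select∣ (P? ∘ suc))
... | no  _ = count≡∣select∣ (P? ∘ suc)

∣p∪q∣≤∣p∣+∣q∣ : (p q : Subset n) → ∣ p ∪ q ∣ ≤ ∣ p ∣ + ∣ q ∣
∣p∪q∣≤∣p∣+∣q∣ []            []            = z≤n
∣p∪q∣≤∣p∣+∣q∣ (inside ∷ p)  (s ∷ q)       = s≤s (≤-trans (∣p∪q∣≤∣p∣+∣q∣ p q) (+-monoʳ-≤ ∣ p ∣ (∣p∣≤∣x∷p∣ s q)))
∣p∪q∣≤∣p∣+∣q∣ (outside ∷ p) (inside ∷ q)  = ≤-trans (s≤s (∣p∪q∣≤∣p∣+∣q∣ p q)) (≤-reflexive (sym (+-suc ∣ p ∣ ∣ q ∣)))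
∣p∪q∣≤∣p∣+∣q∣ (outside ∷ p) (outside ∷ q) = ∣p∪q∣≤∣p∣+∣q∣ p q

Empty⇒∣p∣≡0 : {p : Subset n} → ¬ Nonempty p → ∣ p ∣ ≡ 0
Empty⇒∣p∣≡0 {n} p-empty = trans (cong ∣_∣ (Empty-unique p-empty)) (∣⊥∣≡0 n)

x∉p⇒∣p∣<n : {p : Subset n} {x : Fin n} → x ∉ p → ∣ p ∣ < n
x∉p⇒∣p∣<n {n} x∉p = ≤-trans (p⊂q⇒∣p∣<∣q∣ (⊆⊤ , _ , ∈⊤ , x∉p)) (≤-reflexive (∣⊤∣≡n n))

∣p∣<∣q∣⇒∃[x∈q∖p] : {p q : Subset n} → ∣ p ∣ < ∣ q ∣ → ∃[ x ] x ∈ q × x ∉ p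
∣p∣<∣q∣⇒∃[x∈q∖p] {p = p} {q} ∣p∣<∣q∣ with any? (λ x → x ∈? q ×-dec ¬? (x ∈? p))
... | yes witness = witness
... | no  none    = contradiction (p⊆q⇒∣p∣≤∣q∣ q⊆p) (<⇒≱ ∣p∣<∣q∣)
  where
  q⊆p : q ⊆ p
  q⊆p {x} x∈q = decidable-stable (x ∈? p) (λ x∉p → none (x , x∈q , x∉p))

2+∣p-x-y∣≤∣p∣ : {p : Subset n} {x y : Fin n} → x ∈ p → y ∈ p → y ≢ x → 2 + ∣ p - x - y ∣ ≤ ∣ p ∣
2+∣p-x-y∣≤∣p∣ x∈p y∈p y≢x = ≤-trans (s≤s (x∈p⇒∣p-x∣<∣p∣ (x∈p∧x≢y⇒x∈p-y y∈p y≢x))) (x∈p⇒∣p-x∣<∣p∣ x∈p)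

image : (Fin n₁ → Fin n₂) → Subset n₁ → Subset n₂
image g p = select (λ y → any? (λ x → x ∈? p ×-dec g x ≟ y))

∈-image⁺ : (g : Fin n₁ → Fin n₂) {p : Subset n₁} {x : Fin n₁} → x ∈ p → g x ∈ image g p
∈-image⁺ g x∈p = ∈-select⁺ _ (_ , x∈p , refl)

∈-image⁻ : (g : Fin n₁ → Fin n₂) {p : Subset n₁} {y : Fin n₂} → y ∈ image g p → ∃[ x ] x ∈ p × g x ≡ y
∈-image⁻ g = ∈-select⁻ _

∣image∣≤∣p∣ : (g : Fin n₁ → Fin n₂) (p : Subset n₁) → ∣ image g p ∣ ≤ ∣ p ∣
∣image∣≤∣p∣ g [] = ≤-reflexive (Empty⇒∣p∣≡0 λ (_ , y∈) → case ∈-image⁻ g y∈ of λ ())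
∣image∣≤∣p∣ g (outside ∷ p) = ≤-trans (p⊆q⇒∣p∣≤∣q∣ shift) (∣image∣≤∣p∣ (g ∘ suc) p)
  where
  shift : image g (outside ∷ p) ⊆ image (g ∘ suc) p
  shift y∈ with ∈-image⁻ g y∈
  ... | suc x , there x∈p , refl = ∈-image⁺ (g ∘ suc) x∈p
∣image∣≤∣p∣ g (inside ∷ p) = begin
  ∣ image g (inside ∷ p) ∣                ≤⟨ p⊆q⇒∣p∣≤∣q∣ split ⟩
  ∣ ⁅ g zero ⁆ ∪ image (g ∘ suc) p ∣      ≤⟨ ∣p∪q∣≤∣p∣+∣q∣ ⁅ g zero ⁆ _ ⟩
  ∣ ⁅ g zero ⁆ ∣ + ∣ image (g ∘ suc) p ∣  ≡⟨ cong (_+ ∣ image (g ∘ suc) p ∣) (∣⁅x⁆∣≡1 (g zero)) ⟩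
  suc ∣ image (g ∘ suc) p ∣               ≤⟨ s≤s (∣image∣≤∣p∣ (g ∘ suc) p) ⟩
  suc ∣ p ∣                               ∎
  where
  open ≤-Reasoning
  split : image g (inside ∷ p) ⊆ ⁅ g zero ⁆ ∪ image (g ∘ suc) p
  split y∈ with ∈-image⁻ g y∈
  ... | zero  , _           , refl = x∈p∪q⁺ (inj₁ (x∈⁅x⁆ (g zero)))
  ... | suc x , there x∈p , refl = x∈p∪q⁺ (inj₂ (∈-image⁺ (g ∘ suc) x∈p))

∉-image⇒≢ : (g : Fin n₁ → Fin n₂) {p : Subset n₁} {x : Fin n₁} {y : Fin n₂} → y ∉ image g p → x ∈ p → g x ≢ y
∉-image⇒≢ g y∉ x∈p gx≡y = y∉ (subst (_∈ _) gx≡y (∈-image⁺ g x∈p))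

∈-∪⁅⁆⁻ : {p : Subset n} {x y : Fin n} → y ∈ p ∪ ⁅ x ⁆ → y ∈ p ⊎ y ≡ x
∈-∪⁅⁆⁻ {p = p} {x} y∈ with x∈p∪q⁻ p ⁅ x ⁆ y∈
... | inj₁ y∈p = inj₁ y∈p
... | inj₂ y∈x = inj₂ (x∈⁅y⁆⇒x≡y x y∈x)

InjectiveOn : {A : Set} → Subset n → (Fin n → A) → Set
InjectiveOn p g = ∀ {x y} → x ∈ p → y ∈ p → g x ≡ g y → x ≡ y

module _ {A : Set} (g : Fin n → A) {p : Subset n} {x : Fin n} {y : A} (x∉p : x ∉ p) where

  updateAt-agrees : ∀ {z} → z ∈ p → updateAt g x (const y) z ≡ g z
  updateAt-agrees {z} z∈p = updateAt-minimal z x g (λ z≡x → x∉p (subst (_∈ p) z≡x z∈p))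

  updateAt-injectiveOn : (∀ {z} → z ∈ p → g z ≢ y) → InjectiveOn p g →
                         InjectiveOn (p ∪ ⁅ x ⁆) (updateAt g x (const y))
  updateAt-injectiveOn y-fresh g-inj {z} {z′} z∈ z′∈ eq with ∈-∪⁅⁆⁻ z∈ | ∈-∪⁅⁆⁻ z′∈
  ... | inj₁ z∈p | inj₁ z′∈p = g-inj z∈p z′∈p (trans (sym (updateAt-agrees z∈p)) (trans eq (updateAt-agrees z′∈p)))
  ... | inj₂ refl | inj₂ refl = refl
  ... | inj₂ refl | inj₁ z′∈p =
    contradiction (trans (sym (updateAt-agrees z′∈p)) (trans (sym eq) (updateAt-updates x g))) (y-fresh z′∈p)
  ... | inj₁ z∈p | inj₂ refl =
    contradiction (trans (sym (updateAt-agrees z∈p)) (trans eq (updateAt-updates x g))) (y-fresh z∈p)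

𝟙 : Subset n → Fin n → ℕ
𝟙 p x = if lookup p x then 1 else 0

𝟙-∈ : {p : Subset n} {x : Fin n} → x ∈ p → 𝟙 p x ≡ 1
𝟙-∈ x∈p rewrite []=⇒lookup x∈p = refl

sum-𝟙 : (p : Subset n) → sum (tabulate (𝟙 p)) ≡ ∣ p ∣
sum-𝟙 []            = refl
sum-𝟙 (inside ∷ p)  = cong suc (sum-𝟙 p)
sum-𝟙 (outside ∷ p) = sum-𝟙 p

sum-mono-≤ : (v w : Fin k → ℕ) → (∀ x → v x ≤ w x) → sum (tabulate v) ≤ sum (tabulate w)
sum-mono-≤ {zero}  v w v≤w = z≤n
sum-mono-≤ {suc k} v w v≤w = +-mono-≤ (v≤w zero) (sum-mono-≤ (v ∘ suc) (w ∘ suc) (v≤w ∘ suc))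

sum-linear : (c : ℕ) (v w : Fin k → ℕ) →
             sum (tabulate (λ x → c * v x + w x)) ≡ c * sum (tabulate v) + sum (tabulate w)
sum-linear {zero}  c v w = sym (cong (_+ 0) (*-zeroʳ c))
sum-linear {suc k} c v w = begin
  (c * v zero + w zero) + sum (tabulate (λ x → c * v (suc x) + w (suc x)))
    ≡⟨ cong ((c * v zero + w zero) +_) (sum-linear c (v ∘ suc) (w ∘ suc)) ⟩
  (c * v zero + w zero) + (c * V + W)  ≡⟨ interchange (c * v zero) (w zero) (c * V) W ⟩
  (c * v zero + c * V) + (w zero + W)  ≡⟨ cong (_+ (w zero + W)) (*-distribˡ-+ c (v zero) V) ⟨
  c * (v zero + V) + (w zero + W)      ∎
  where
  open ≡-Reasoning
  V = sum (tabulate (v ∘ suc))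
  W = sum (tabulate (w ∘ suc))

∣⋃∣≤sum : (F : Fin k → Subset n) → ∣ ⋃ (tabulate F) ∣ ≤ sum (tabulate (∣_∣ ∘ F))
∣⋃∣≤sum {zero}  {n} F = ≤-reflexive (∣⊥∣≡0 n)
∣⋃∣≤sum {suc k}     F = ≤-trans (∣p∪q∣≤∣p∣+∣q∣ (F zero) _) (+-monoʳ-≤ ∣ F zero ∣ (∣⋃∣≤sum (F ∘ suc)))

∈-⋃⁺ : (F : Fin k → Subset n) (e : Fin k) {x : Fin n} → x ∈ F e → x ∈ ⋃ (tabulate F)
∈-⋃⁺ F zero    x∈ = x∈p∪q⁺ (inj₁ x∈)
∈-⋃⁺ F (suc e) x∈ = x∈p∪q⁺ (inj₂ (∈-⋃⁺ (F ∘ suc) e x∈))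

module _ {_~_ : Fin n → Fin n → Set} (_~?_ : Decidable _~_) where

  neighbours : Subset n → Fin n → Subset n
  neighbours S v = select (λ u → u ∈? S ×-dec (¬? (u ≟ v) ×-dec u ~? v))

  ∈-neighbours⁺ : ∀ {S u v} → u ∈ S → u ≢ v → u ~ v → u ∈ neighbours S v
  ∈-neighbours⁺ u∈S u≢v u~v = ∈-select⁺ _ (u∈S , u≢v , u~v)

  ∈-neighbours⁻ : ∀ {S u v} → u ∈ neighbours S v → u ∈ S × u ≢ v × u ~ v
  ∈-neighbours⁻ = ∈-select⁻ _

  -- (d ∸ 1)-degeneracy in the usual terminology
  Degenerate : ℕ → Set
  Degenerate d = ∀ {S} → Nonempty S → ∃[ v ] v ∈ S × ∣ neighbours S v ∣ < d

  module _ {d : ℕ} (~-sym : Symmetric _~_) (degenerate : Degenerate d) where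

    ProperOn : Subset n → (Fin n → Fin d) → Set
    ProperOn S c = ∀ {u w} → u ∈ S → w ∈ S → u ~ w → c u ≡ c w → u ≡ w

    private
      anyColour : Fin n → Fin d
      anyColour x = fromℕ< (≤-trans (s≤s z≤n) (proj₂ (proj₂ (degenerate (x , x∈⁅x⁆ x)))))

      colour-last : ∀ {S v} → v ∈ S → ∣ neighbours S v ∣ < d →
                    Σ (Fin n → Fin d) (ProperOn (S - v)) → Σ (Fin n → Fin d) (ProperOn S)
      colour-last {S} {v} v∈S sparse (c′ , proper′) = c , proper
        where
        used : Subset d
        used = image c′ (neighbours S v)

        free : ∃[ κ ] κ ∈ ⊤ × κ ∉ used
        free = ∣p∣<∣q∣⇒∃[x∈q∖p] {q = ⊤} (begin-strict
          ∣ used ∣               ≤⟨ ∣image∣≤∣p∣ c′ (neighbours S v) ⟩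
          ∣ neighbours S v ∣     <⟨ sparse ⟩
          d                      ≡⟨ ∣⊤∣≡n d ⟨
          ∣ ⊤ {d} ∣              ∎)
          where open ≤-Reasoning

        c : Fin n → Fin d
        c = updateAt c′ v (const (proj₁ free))

        c-elsewhere : ∀ {u} → u ≢ v → c u ≡ c′ u
        c-elsewhere {u} u≢v = updateAt-minimal u v c′ u≢v

        neighbour-clash : ∀ {w} → w ∈ S → w ≢ v → w ~ v → c w ≢ c v
        neighbour-clash {w} w∈S w≢v w~v cw≡cv = proj₂ (proj₂ free) (subst (_∈ used) c′w≡κ c′w∈used)
          where
          c′w≡κ : c′ w ≡ proj₁ free
          c′w≡κ = trans (sym (c-elsewhere w≢v)) (trans cw≡cv (updateAt-updates v c′))
          c′w∈used : c′ w ∈ used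
          c′w∈used = ∈-image⁺ c′ (∈-neighbours⁺ w∈S w≢v w~v)

        proper : ProperOn S c
        proper {u} {w} u∈S w∈S u~w cu≡cw with u ≟ v | w ≟ v
        ... | yes refl | yes refl = refl
        ... | yes refl | no w≢v   = contradiction (sym cu≡cw) (neighbour-clash w∈S w≢v (~-sym u~w))
        ... | no u≢v   | yes refl = contradiction cu≡cw (neighbour-clash u∈S u≢v u~w)
        ... | no u≢v   | no w≢v   = proper′ (x∈p∧x≢y⇒x∈p-y u∈S u≢v) (x∈p∧x≢y⇒x∈p-y w∈S w≢v) u~w
                                      (trans (sym (c-elsewhere u≢v)) (trans cu≡cw (c-elsewhere w≢v)))

      colourOn : (S : Subset n) → Acc _⊂_ S → Σ (Fin n → Fin d) (ProperOn S)
      colourOn S (acc smaller) with nonempty? S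
      ... | no  S-empty    = anyColour , λ u∈S → contradiction (_ , u∈S) S-empty
      ... | yes S-nonempty with degenerate S-nonempty
      ...   | v , v∈S , sparse = colour-last v∈S sparse (colourOn (S - v) (smaller (x∈p⇒p-x⊂p v∈S)))

    degenerate⇒colourable : Σ (Fin n → Fin d) λ c → ∀ {u w} → u ~ w → c u ≡ c w → u ≡ w
    degenerate⇒colourable with colourOn ⊤ (⊂-wellFounded ⊤)
    ... | c , proper = c , proper ∈⊤ ∈⊤

module _ {t k} (G : Graph t k) where

  Joins : Fin k → Fin t → Fin t → Set
  Joins e x w = (edge G e ≡ (x , w)) ⊎ (edge G e ≡ (w , x))

  both-ends : {P : Fin t → Set} {e : Fin k} {x w : Fin t} → Joins e x w → P x → P w →
              P (proj₁ (edge G e)) × P (proj₂ (edge G e))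
  both-ends (inj₁ e≡xw) px pw rewrite e≡xw = px , pw
  both-ends (inj₂ e≡wx) px pw rewrite e≡wx = pw , px

  endpoint : {P : Fin t → Set} {e : Fin k} {v : Fin t} → Incident G v e →
             P (proj₁ (edge G e)) × P (proj₂ (edge G e)) → P v
  endpoint (inj₁ refl) (p₁ , _) = p₁
  endpoint (inj₂ refl) (_ , p₂) = p₂

  joins⇒incident : {e : Fin k} {x w : Fin t} → Joins e x w → Incident G x e
  joins⇒incident (inj₁ e≡xw) = inj₁ (cong proj₁ e≡xw)
  joins⇒incident (inj₂ e≡wx) = inj₂ (cong proj₂ e≡wx)

  incident? : ∀ v e → Dec (Incident G v e)
  incident? v e = (proj₁ (edge G e) ≟ v) ⊎-dec (proj₂ (edge G e) ≟ v)

  incidences : Fin t → Subset k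
  incidences v = select (incident? v)

  ∣incidences∣≡degree : ∀ v → ∣ incidences v ∣ ≡ degree G v
  ∣incidences∣≡degree v = sym (count≡∣select∣ (incident? v))

  frontier : (A : Subset t) {a y : Fin t} → Walk G a y → a ∈ A → y ∉ A →
             ∃₂ λ x w → x ∈ A × w ∉ A × Adj G x w
  frontier A here                  a∈A y∉A = contradiction a∈A y∉A
  frontier A (step {w = w} adj walk) a∈A y∉A with w ∈? A
  ... | yes w∈A = frontier A walk w∈A y∉A
  ... | no  w∉A = _ , w , a∈A , w∉A , adj

module _ {n m} (H : Hypergraph n m) where

  Shadow : Fin n → Fin n → Set
  Shadow u v = ∃[ i ] u ∈ hyperedge H i × v ∈ hyperedge H i

  shadow? : Decidable Shadow
  shadow? u v = any? (λ i → u ∈? hyperedge H i ×-dec v ∈? hyperedge H i)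

  shadow-sym : Symmetric Shadow
  shadow-sym (i , u∈i , v∈i) = i , v∈i , u∈i

u+[R*u+c]<k+R*[k∸1]+Δ∸1 : ∀ R {k Δ u c} → u < k → c < Δ → u + (R * u + c) < k + R * (k ∸ 1) + Δ ∸ 1
u+[R*u+c]<k+R*[k∸1]+Δ∸1 R {suc k} {suc Δ} {u} {c} (s≤s u≤k) (s≤s c≤Δ) = begin-strict
  u + (R * u + c)      ≡⟨ +-assoc u (R * u) c ⟨
  u + R * u + c        ≤⟨ +-mono-≤ (+-mono-≤ u≤k (*-monoʳ-≤ R u≤k)) c≤Δ ⟩
  k + R * k + Δ        <⟨ n<1+n _ ⟩
  suc (k + R * k + Δ)  ≡⟨ +-suc (k + R * k) Δ ⟨
  k + R * k + suc Δ    ∎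
  where open ≤-Reasoning

module BergeEmbedding
  {n m r k Δ : ℕ} (H : Hypergraph n m) (T : Graph (suc k) k)
  (small : ∀ i → ∣ hyperedge H i ∣ ≤ r)
  (connected : Connected T) (Δ-bound : ∀ x → degree T x ≤ Δ)
  {S : Subset n} {s₀ : Fin n} (s₀∈S : s₀ ∈ S)
  (rich : ∀ {v} → v ∈ S → k + (r ∸ 3) * (k ∸ 1) + Δ ∸ 1 ≤ ∣ neighbours (shadow? H) S v ∣)
  where

  private
    R : ℕ
    R = r ∸ 3

  record PartialCopy : Set where
    field
      A           : Subset (suc k)
      U           : Subset k
      φ           : Fin (suc k) → Fin n
      f           : Fin k → Fin m
      root∈A      : zero ∈ A
      ∣A∣≤1+∣U∣   : ∣ A ∣ ≤ suc ∣ U ∣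
      φ-injective : InjectiveOn A φ
      f-injective : InjectiveOn U f
      ends∈A      : ∀ {e} → e ∈ U → proj₁ (edge T e) ∈ A × proj₂ (edge T e) ∈ A
      ends∈f      : ∀ {e} → e ∈ U → φ (proj₁ (edge T e)) ∈ hyperedge H (f e)
                                   × φ (proj₂ (edge T e)) ∈ hyperedge H (f e)
      φ[A]⊆S      : ∀ {a} → a ∈ A → φ a ∈ S

  start : (Fin k → Fin m) → PartialCopy
  start f₀ = record
    { A           = ⁅ zero ⁆
    ; U           = ∅
    ; φ           = const s₀
    ; f           = f₀
    ; root∈A      = x∈⁅x⁆ zero
    ; ∣A∣≤1+∣U∣   = ≤-reflexive (trans (∣⁅x⁆∣≡1 {suc k} zero) (cong suc (sym (∣⊥∣≡0 k))))
    ; φ-injective = λ a∈ b∈ _ → trans (x∈⁅y⁆⇒x≡y zero a∈) (sym (x∈⁅y⁆⇒x≡y zero b∈))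
    ; f-injective = λ e∈∅ → contradiction e∈∅ ∉⊥
    ; ends∈A      = λ e∈∅ → contradiction e∈∅ ∉⊥
    ; ends∈f      = λ e∈∅ → contradiction e∈∅ ∉⊥
    ; φ[A]⊆S      = λ _ → s₀∈S
    }

  ∣U∩incidences∣<Δ : {U : Subset k} {x : Fin (suc k)} {e : Fin k} →
                     e ∉ U → e ∈ incidences T x → ∣ U ∩ incidences T x ∣ < Δ
  ∣U∩incidences∣<Δ {U} {x} e∉U e∈I = begin-strict
    ∣ U ∩ incidences T x ∣  <⟨ p⊂q⇒∣p∣<∣q∣ (p∩q⊆q U _ , _ , e∈I , e∉U ∘ proj₁ ∘ x∈p∩q⁻ U _) ⟩
    ∣ incidences T x ∣      ≡⟨ ∣incidences∣≡degree T x ⟩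
    degree T x              ≤⟨ Δ-bound x ⟩
    Δ                       ∎
    where open ≤-Reasoning

  module _ (s : PartialCopy) where
    open PartialCopy s

    frontier-edge-unused : {x w : Fin (suc k)} {e : Fin k} → w ∉ A → Joins T e x w → e ∉ U
    frontier-edge-unused w∉A joins e∈U = w∉A (endpoint T (joins⇒incident T (swap joins)) (ends∈A e∈U))

    record Attachment (x : Fin (suc k)) : Set where
      field
        u     : Fin n
        i     : Fin m
        u∈S   : u ∈ S
        u-new : ∀ {a} → a ∈ A → φ a ≢ u
        φx∈i  : φ x ∈ hyperedge H i
        u∈i   : u ∈ hyperedge H i
        i-new : ∀ {e} → e ∈ U → f e ≢ i

    module _ {x : Fin (suc k)} {e : Fin k} (x∈A : x ∈ A) (e∉U : e ∉ U) (e∈I : e ∈ incidences T x) where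

      spoiled : Fin k → Subset n
      spoiled e′ = select λ z → e′ ∈? U ×-dec (φ x ∈? hyperedge H (f e′) ×-dec
                                (z ∈? hyperedge H (f e′) ×-dec ¬? (z ∈? image φ A)))

      ∈-spoiled⁺ : ∀ {e′ z} → e′ ∈ U → φ x ∈ hyperedge H (f e′) → z ∈ hyperedge H (f e′) → z ∉ image φ A →
                   z ∈ spoiled e′
      ∈-spoiled⁺ e′∈U φx∈q z∈q z-new = ∈-select⁺ _ (e′∈U , φx∈q , z∈q , z-new)

      ∈-spoiled⁻ : ∀ {e′ z} → z ∈ spoiled e′ →
                   e′ ∈ U × φ x ∈ hyperedge H (f e′) × z ∈ hyperedge H (f e′) × z ∉ image φ A
      ∈-spoiled⁻ = ∈-select⁻ _

      blocked : Subset n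
      blocked = image φ (A - x) ∪ ⋃ (tabulate spoiled)

      module UsedHyperedge {e′ : Fin k} (e′∈U : e′ ∈ U) (φx∈q : φ x ∈ hyperedge H (f e′)) where
        private
          q : Subset n
          q = hyperedge H (f e′)
          a b : Fin (suc k)
          a = proj₁ (edge T e′)
          b = proj₂ (edge T e′)

        φb≢φa : φ b ≢ φ a
        φb≢φa φb≡φa = loopless T e′ (sym (φ-injective (proj₂ (ends∈A e′∈U)) (proj₁ (ends∈A e′∈U)) φb≡φa))

        spoiled⊆q-φa-φb : spoiled e′ ⊆ q - φ a - φ b
        spoiled⊆q-φa-φb z∈ with ∈-spoiled⁻ z∈
        ... | _ , _ , z∈q , z-new = x∈p∧x≢y⇒x∈p-y (x∈p∧x≢y⇒x∈p-y z∈q (≢-sym (∉-image⇒≢ φ z-new (proj₁ (ends∈A e′∈U)))))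
                                                  (≢-sym (∉-image⇒≢ φ z-new (proj₂ (ends∈A e′∈U))))

        2+∣spoiled∣≤r : 2 + ∣ spoiled e′ ∣ ≤ r
        2+∣spoiled∣≤r = begin
          2 + ∣ spoiled e′ ∣      ≤⟨ +-monoʳ-≤ 2 (p⊆q⇒∣p∣≤∣q∣ spoiled⊆q-φa-φb) ⟩
          2 + ∣ q - φ a - φ b ∣   ≤⟨ 2+∣p-x-y∣≤∣p∣ (proj₁ (ends∈f e′∈U)) (proj₂ (ends∈f e′∈U)) φb≢φa ⟩
          ∣ q ∣                   ≤⟨ small (f e′) ⟩
          r                       ∎
          where open ≤-Reasoning

        3+∣spoiled∣≤r : ¬ Incident T x e′ → 3 + ∣ spoiled e′ ∣ ≤ r
        3+∣spoiled∣≤r x∉e′ = begin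
          3 + ∣ spoiled e′ ∣            ≤⟨ +-monoʳ-≤ 3 (p⊆q⇒∣p∣≤∣q∣ spoiled⊆q-φa-φb-φx) ⟩
          2 + suc ∣ q - φ a - φ b - φ x ∣ ≤⟨ +-monoʳ-≤ 2 (x∈p⇒∣p-x∣<∣p∣ φx∈q-φa-φb) ⟩
          2 + ∣ q - φ a - φ b ∣         ≤⟨ 2+∣p-x-y∣≤∣p∣ (proj₁ (ends∈f e′∈U)) (proj₂ (ends∈f e′∈U)) φb≢φa ⟩
          ∣ q ∣                         ≤⟨ small (f e′) ⟩
          r                             ∎
          where
          open ≤-Reasoning
          φx≢φ : ∀ {c} → c ∈ A → c ≢ x → φ x ≢ φ c
          φx≢φ c∈A c≢x φx≡φc = c≢x (φ-injective c∈A x∈A (sym φx≡φc))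
          φx∈q-φa-φb : φ x ∈ q - φ a - φ b
          φx∈q-φa-φb = x∈p∧x≢y⇒x∈p-y (x∈p∧x≢y⇒x∈p-y φx∈q (φx≢φ (proj₁ (ends∈A e′∈U)) (x∉e′ ∘ inj₁)))
                                                   (φx≢φ (proj₂ (ends∈A e′∈U)) (x∉e′ ∘ inj₂))
          spoiled⊆q-φa-φb-φx : spoiled e′ ⊆ q - φ a - φ b - φ x
          spoiled⊆q-φa-φb-φx z∈ with ∈-spoiled⁻ z∈
          ... | _ , _ , _ , z-new = x∈p∧x≢y⇒x∈p-y (spoiled⊆q-φa-φb z∈) (≢-sym (∉-image⇒≢ φ z-new x∈A))


        ∣spoiled∣≤R+𝟙 : ∣ spoiled e′ ∣ ≤ R + 𝟙 (U ∩ incidences T x) e′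
        ∣spoiled∣≤R+𝟙 = case incident? T x e′ of λ where
            (yes x∈e′) → +-cancelˡ-≤ 2 _ _ (begin
              2 + ∣ spoiled e′ ∣                     ≤⟨ 2+∣spoiled∣≤r ⟩
              r                                      ≤⟨ m≤n+m∸n r 3 ⟩
              2 + (1 + R)                            ≡⟨ cong (2 +_) (+-comm 1 R) ⟩
              2 + (R + 1)                            ≡⟨ cong (λ c → 2 + (R + c)) (𝟙-∈ (x∈p∩q⁺ (e′∈U , ∈-select⁺ _ x∈e′))) ⟨
              2 + (R + 𝟙 (U ∩ incidences T x) e′)    ∎)
            (no x∉e′) → ≤-trans (+-cancelˡ-≤ 3 _ _ (≤-trans (3+∣spoiled∣≤r x∉e′) (m≤n+m∸n r 3))) (m≤m+n R _)
          where open ≤-Reasoning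

      ∣spoiled∣≤ : ∀ e′ → ∣ spoiled e′ ∣ ≤ R * 𝟙 U e′ + 𝟙 (U ∩ incidences T x) e′
      ∣spoiled∣≤ e′ = case e′ ∈? U ×-dec φ x ∈? hyperedge H (f e′) of λ where
          (yes (e′∈U , φx∈q)) → begin
            ∣ spoiled e′ ∣                              ≤⟨ UsedHyperedge.∣spoiled∣≤R+𝟙 e′∈U φx∈q ⟩
            R + 𝟙 (U ∩ incidences T x) e′               ≡⟨ cong (_+ 𝟙 (U ∩ incidences T x) e′) (*-identityʳ R) ⟨
            R * 1 + 𝟙 (U ∩ incidences T x) e′           ≡⟨ cong (λ c → R * c + 𝟙 (U ∩ incidences T x) e′) (𝟙-∈ e′∈U) ⟨
            R * 𝟙 U e′ + 𝟙 (U ∩ incidences T x) e′      ∎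
          (no dead) → ≤-trans (≤-reflexive (Empty⇒∣p∣≡0 λ (_ , z∈) → dead (Product.map₂ proj₁ (∈-spoiled⁻ z∈)))) z≤n
        where open ≤-Reasoning

      ∣blocked∣<D : ∣ blocked ∣ < k + R * (k ∸ 1) + Δ ∸ 1
      ∣blocked∣<D = begin-strict
        ∣ blocked ∣
          ≤⟨ ∣p∪q∣≤∣p∣+∣q∣ (image φ (A - x)) _ ⟩
        ∣ image φ (A - x) ∣ + ∣ ⋃ (tabulate spoiled) ∣
          ≤⟨ +-mono-≤ (∣image∣≤∣p∣ φ (A - x)) (∣⋃∣≤sum spoiled) ⟩
        ∣ A - x ∣ + sum (tabulate (∣_∣ ∘ spoiled))
          ≤⟨ +-mono-≤ (≤-pred (≤-trans (x∈p⇒∣p-x∣<∣p∣ x∈A) ∣A∣≤1+∣U∣)) (sum-mono-≤ _ _ ∣spoiled∣≤) ⟩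
        ∣ U ∣ + sum (tabulate (λ e′ → R * 𝟙 U e′ + 𝟙 (U ∩ incidences T x) e′))
          ≡⟨ cong (∣ U ∣ +_) (trans (sum-linear R (𝟙 U) (𝟙 (U ∩ incidences T x)))
                                    (cong₂ (λ p q → R * p + q) (sum-𝟙 U) (sum-𝟙 (U ∩ incidences T x)))) ⟩
        ∣ U ∣ + (R * ∣ U ∣ + ∣ U ∩ incidences T x ∣)
          <⟨ u+[R*u+c]<k+R*[k∸1]+Δ∸1 R (x∉p⇒∣p∣<n e∉U) (∣U∩incidences∣<Δ e∉U e∈I) ⟩
        k + R * (k ∸ 1) + Δ ∸ 1
          ∎
        where open ≤-Reasoning

      attachment : Attachment x
      attachment with ∣p∣<∣q∣⇒∃[x∈q∖p] (≤-trans ∣blocked∣<D (rich (φ[A]⊆S x∈A)))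
      ... | u , u∈N , u∉blocked with ∈-neighbours⁻ (shadow? H) u∈N
      ...   | u∈S , u≢φx , i , u∈i , φx∈i = record
        { u = u ; i = i ; u∈S = u∈S ; u-new = ∉-image⇒≢ φ u∉φ[A] ; φx∈i = φx∈i ; u∈i = u∈i ; i-new = i-new }
        where
        u∉φ[A] : u ∉ image φ A
        u∉φ[A] u∈ with ∈-image⁻ φ u∈
        ... | a , a∈A , φa≡u with a ≟ x
        ...   | yes refl = u≢φx (sym φa≡u)
        ...   | no  a≢x  = u∉blocked (x∈p∪q⁺ (inj₁ (subst (_∈ image φ (A - x)) φa≡u (∈-image⁺ φ (x∈p∧x≢y⇒x∈p-y a∈A a≢x)))))
        i-new : ∀ {e′} → e′ ∈ U → f e′ ≢ i
        i-new {e′} e′∈U fe′≡i = u∉blocked (x∈p∪q⁺ (inj₂ (∈-⋃⁺ spoiled e′ (∈-spoiled⁺ e′∈U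
          (subst (λ j → φ x ∈ hyperedge H j) (sym fe′≡i) φx∈i)
          (subst (λ j → u ∈ hyperedge H j) (sym fe′≡i) u∈i) u∉φ[A]))))

    extend : {x w : Fin (suc k)} {e : Fin k} → x ∈ A → w ∉ A → Joins T e x w → Attachment x →
             Σ PartialCopy λ s′ → U ⊂ PartialCopy.U s′
    extend {x} {w} {e} x∈A w∉A joins att = grown , U⊂U′
      where
      open Attachment att

      e∉U : e ∉ U
      e∉U = frontier-edge-unused w∉A joins

      U′ : Subset k
      U′ = U ∪ ⁅ e ⁆

      U⊂U′ : U ⊂ U′
      U⊂U′ = p⊆p∪q ⁅ e ⁆ , e , x∈p∪q⁺ (inj₂ (x∈⁅x⁆ e)) , e∉U

      A⊆A′ : A ⊆ A ∪ ⁅ w ⁆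
      A⊆A′ = p⊆p∪q ⁅ w ⁆

      φ′ : Fin (suc k) → Fin n
      φ′ = updateAt φ w (const u)

      f′ : Fin k → Fin m
      f′ = updateAt f e (const i)

      moved : ∀ {y e′} → y ∈ A → e′ ∈ U → φ y ∈ hyperedge H (f e′) → φ′ y ∈ hyperedge H (f′ e′)
      moved y∈A e′∈U = subst₂ _∈_ (sym (updateAt-agrees φ w∉A y∈A)) (cong (hyperedge H) (sym (updateAt-agrees f e∉U e′∈U)))

      ends∈A′ : ∀ {e′} → e′ ∈ U′ → proj₁ (edge T e′) ∈ A ∪ ⁅ w ⁆ × proj₂ (edge T e′) ∈ A ∪ ⁅ w ⁆
      ends∈A′ e′∈U′ with ∈-∪⁅⁆⁻ e′∈U′
      ... | inj₁ e′∈U = Product.map A⊆A′ A⊆A′ (ends∈A e′∈U)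
      ... | inj₂ refl = both-ends T joins (A⊆A′ x∈A) (x∈p∪q⁺ (inj₂ (x∈⁅x⁆ w)))

      ends∈f′ : ∀ {e′} → e′ ∈ U′ → φ′ (proj₁ (edge T e′)) ∈ hyperedge H (f′ e′)
                                 × φ′ (proj₂ (edge T e′)) ∈ hyperedge H (f′ e′)
      ends∈f′ e′∈U′ with ∈-∪⁅⁆⁻ e′∈U′
      ... | inj₁ e′∈U = Product.map (moved (proj₁ (ends∈A e′∈U)) e′∈U) (moved (proj₂ (ends∈A e′∈U)) e′∈U) (ends∈f e′∈U)
      ... | inj₂ refl = both-ends T {P = λ y → φ′ y ∈ hyperedge H (f′ e)} joins
        (subst₂ _∈_ (sym (updateAt-agrees φ w∉A x∈A)) i≡f′e φx∈i)
        (subst₂ _∈_ (sym (updateAt-updates w φ)) i≡f′e u∈i)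
        where
        i≡f′e : hyperedge H i ≡ hyperedge H (f′ e)
        i≡f′e = cong (hyperedge H) (sym (updateAt-updates e f))

      φ′[A′]⊆S : ∀ {a} → a ∈ A ∪ ⁅ w ⁆ → φ′ a ∈ S
      φ′[A′]⊆S a∈A′ with ∈-∪⁅⁆⁻ a∈A′
      ... | inj₁ a∈A = subst (_∈ S) (sym (updateAt-agrees φ w∉A a∈A)) (φ[A]⊆S a∈A)
      ... | inj₂ refl = subst (_∈ S) (sym (updateAt-updates w φ)) u∈S

      ∣A′∣≤1+∣U′∣ : ∣ A ∪ ⁅ w ⁆ ∣ ≤ suc ∣ U′ ∣
      ∣A′∣≤1+∣U′∣ = begin
        ∣ A ∪ ⁅ w ⁆ ∣        ≤⟨ ∣p∪q∣≤∣p∣+∣q∣ A ⁅ w ⁆ ⟩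
        ∣ A ∣ + ∣ ⁅ w ⁆ ∣    ≡⟨ cong (∣ A ∣ +_) (∣⁅x⁆∣≡1 w) ⟩
        ∣ A ∣ + 1            ≡⟨ +-comm ∣ A ∣ 1 ⟩
        suc ∣ A ∣            ≤⟨ s≤s ∣A∣≤1+∣U∣ ⟩
        suc (suc ∣ U ∣)      ≤⟨ s≤s (p⊂q⇒∣p∣<∣q∣ U⊂U′) ⟩
        suc ∣ U′ ∣           ∎
        where open ≤-Reasoning

      grown : PartialCopy
      grown = record
        { A           = A ∪ ⁅ w ⁆
        ; U           = U′
        ; φ           = φ′
        ; f           = f′
        ; root∈A      = A⊆A′ root∈A
        ; ∣A∣≤1+∣U∣   = ∣A′∣≤1+∣U′∣
        ; φ-injective = updateAt-injectiveOn φ w∉A u-new φ-injective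
        ; f-injective = updateAt-injectiveOn f e∉U i-new f-injective
        ; ends∈A      = ends∈A′
        ; ends∈f      = ends∈f′
        ; φ[A]⊆S      = φ′[A′]⊆S
        }

  complete : (s : PartialCopy) → (∀ y → y ∈ PartialCopy.A s) → HasBergeCopy H T
  complete s all∈A = φ , f , φ-injective (all∈A _) (all∈A _) , f-injective (all∈U _) (all∈U _) , ends∈f ∘ all∈U
    where
    open PartialCopy s
    k≤∣U∣ : k ≤ ∣ U ∣
    k≤∣U∣ = ≤-pred (begin
      suc k          ≡⟨ ∣⊤∣≡n (suc k) ⟨
      ∣ ⊤ {suc k} ∣  ≤⟨ p⊆q⇒∣p∣≤∣q∣ {p = ⊤} (λ {y} _ → all∈A y) ⟩
      ∣ A ∣          ≤⟨ ∣A∣≤1+∣U∣ ⟩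
      suc ∣ U ∣      ∎)
      where open ≤-Reasoning
    all∈U : ∀ e → e ∈ U
    all∈U e = subst (e ∈_) (sym (∣p∣≡n⇒p≡⊤ (≤-antisym (∣p∣≤n U) k≤∣U∣))) ∈⊤

  grow : (s : PartialCopy) → Acc _⊃_ (PartialCopy.U s) → HasBergeCopy H T
  grow s (acc larger) with any? (λ y → ¬? (y ∈? PartialCopy.A s))
  ... | no  none = complete s λ y → decidable-stable (y ∈? PartialCopy.A s) (λ y∉A → none (y , y∉A))
  ... | yes (y , y∉A) with frontier T (PartialCopy.A s) (connected zero y) (PartialCopy.root∈A s) y∉A
  ...   | x , w , x∈A , w∉A , e , joins with extend s x∈A w∉A joins
          (attachment s x∈A (frontier-edge-unused s w∉A joins) (∈-select⁺ _ (joins⇒incident T joins)))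
  ...     | s′ , U⊂U′ = grow s′ (larger U⊂U′)

  -- f is total, so even the empty partial copy needs a hyperedge as soon as T has an edge.
  someHyperedge : Fin k → Fin m
  someHyperedge e with ∣p∣<∣q∣⇒∃[x∈q∖p] {p = ∅} (begin-strict
      ∣ ∅ {n} ∣                            ≡⟨ ∣⊥∣≡0 n ⟩
      0                                    <⟨ ≤-trans (s≤s z≤n) (u+[R*u+c]<k+R*[k∸1]+Δ∸1 R {u = 0} {c = 0} 0<k 0<Δ) ⟩
      k + R * (k ∸ 1) + Δ ∸ 1              ≤⟨ rich s₀∈S ⟩
      ∣ neighbours (shadow? H) S s₀ ∣      ∎)
    where
    open ≤-Reasoning
    0<k : 0 < k
    0<k = ≤-trans (s≤s z≤n) (toℕ<n e)
    0<Δ : 0 < Δ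
    0<Δ = ≤-trans (s≤s z≤n) (∣U∩incidences∣<Δ {U = ∅} {proj₁ (edge T e)} {e} ∉⊥ (∈-select⁺ _ (inj₁ refl)))
  ... | _ , u∈N , _ = proj₁ (proj₂ (proj₂ (∈-neighbours⁻ (shadow? H) u∈N)))

  bergeCopy : HasBergeCopy H T
  bergeCopy = grow (start someHyperedge) (⊃-wellFounded _)

proposition4p1 : (r k Δ : ℕ) → 3 ≤ r →
    (T : Graph (suc k) k) → IsTree T → MaxDegree T Δ →
    (n m : ℕ) (H : Hypergraph n m) →
    (∀ (i : Fin m) → 2 ≤ ∣ hyperedge H i ∣ × ∣ hyperedge H i ∣ ≤ r) →
    ¬ HasBergeCopy H T →
    χs≤ H (k + (r ∸ 3) * (k ∸ 1) + Δ ∸ 1)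
proposition4p1 r k Δ _ T (connected , _) (Δ-bound , _) n m H sizes noCopy =
  colour , λ i u v u∈i v∈i → proper (i , u∈i , v∈i)
  where
  D : ℕ
  D = k + (r ∸ 3) * (k ∸ 1) + Δ ∸ 1

  degenerate : Degenerate (shadow? H) D
  degenerate {S} (s₀ , s₀∈S) with any? (λ v → v ∈? S ×-dec ∣ neighbours (shadow? H) S v ∣ <? D)
  ... | yes sparse = sparse
  ... | no  none   = contradiction (BergeEmbedding.bergeCopy H T (proj₂ ∘ sizes) connected Δ-bound s₀∈S rich) noCopy
    where
    rich : ∀ {v} → v ∈ S → D ≤ ∣ neighbours (shadow? H) S v ∣
    rich {v} v∈S = ≮⇒≥ λ sparse → none (v , v∈S , sparse)

  open Σ (degenerate⇒colourable (shadow? H) (shadow-sym H) degenerate) renaming (proj₁ to colour; proj₂ to proper)
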